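{- In every contact $B_0$-VPG representation of a hole, the number of corners is even.
   Context: A contact $B_0$-VPG representation of a graph $G$ is a collection of nontrivial horizontal and vertical segments ("lines") on a grid, pairwise interiorly disjoint, in one-to-one correspondence with $V(G)$, such that two vertices are adjacent iff their segments share a grid point that is an endpoint of at least one of them. A corner of a representation is a grid point that belongs to both a vertical line and a horizontal line of the representation. A hole is an induced cycle of length at least 4. -}

module Defs where

open import Data.Nat using (ℕ; zero; suc)
open import Data.Unit using (⊤)
open import Data.Empty using (⊥)
open import Data.Integer using (ℤ; _<_; _≤_)
open import Data.Fin using (Fin; toℕ)
open import Data.Product using (_×_; _,_; ∃)
open import Data.Sum using (_⊎_)
open import Data.List using (List; length)
open import Data.List.Membership.Propositional using (_∈_)
open import Data.List.Relation.Unary.Unique.Propositional using (Unique)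
open import Relation.Nullary using (¬_)
open import Relation.Binary.PropositionalEquality using (_≡_; _≢_)
open import Function.Bundles using (_⇔_)

Point : Set
Point = ℤ × ℤ

-- Axis-parallel grid segments ("lines").
--   hor y x₁ x₂ : horizontal segment from (x₁ , y) to (x₂ , y)
--   ver x y₁ y₂ : vertical segment   from (x , y₁) to (x , y₂)
data Seg : Set where
  hor : (y x₁ x₂ : ℤ) → Seg
  ver : (x y₁ y₂ : ℤ) → Seg

Nontrivial : Seg → Set
Nontrivial (hor y a b) = a < b
Nontrivial (ver x a b) = a < b

IsHorizontal : Seg → Set
IsHorizontal (hor _ _ _) = ⊤
IsHorizontal (ver _ _ _) = ⊥

IsVertical : Seg → Set
IsVertical (hor _ _ _) = ⊥
IsVertical (ver _ _ _) = ⊤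

OnSeg : Point → Seg → Set
OnSeg (px , py) (hor y a b) = py ≡ y × a ≤ px × px ≤ b
OnSeg (px , py) (ver x a b) = px ≡ x × a ≤ py × py ≤ b

IsEndpoint : Point → Seg → Set
IsEndpoint p (hor y a b) = p ≡ (a , y) ⊎ p ≡ (b , y)
IsEndpoint p (ver x a b) = p ≡ (x , a) ⊎ p ≡ (x , b)

-- Interiorly disjoint: no (real) point lies in the relative interior of both
-- segments (interior = segment minus its endpoints).
InteriorlyDisjoint : Seg → Seg → Set
InteriorlyDisjoint (hor y a b) (hor y′ c d) = y ≡ y′ → ¬ (a < d × c < b)
InteriorlyDisjoint (ver x a b) (ver x′ c d) = x ≡ x′ → ¬ (a < d × c < b)
InteriorlyDisjoint (hor y a b) (ver x c d) = ¬ (a < x × x < b × c < y × y < d)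
InteriorlyDisjoint (ver x c d) (hor y a b) = ¬ (a < x × x < b × c < y × y < d)

Contact : Seg → Seg → Set
Contact s t = ∃ λ (p : Point) → OnSeg p s × OnSeg p t × (IsEndpoint p s ⊎ IsEndpoint p t)

-- The hole (chordless cycle) C_n on vertex set Fin n: i ~ j iff they are
-- consecutive modulo n.
CycleAdj : (n : ℕ) → Fin n → Fin n → Set
CycleAdj n i j =
    suc (toℕ i) ≡ toℕ j
  ⊎ suc (toℕ j) ≡ toℕ i
  ⊎ (toℕ i ≡ 0 × suc (toℕ j) ≡ n)
  ⊎ (toℕ j ≡ 0 × suc (toℕ i) ≡ n)

record IsContactB0VPG (n : ℕ) (Adj : Fin n → Fin n → Set) (rep : Fin n → Seg) : Set where
  field
    nontrivial : ∀ i → Nontrivial (rep i)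
    injective  : ∀ i j → rep i ≡ rep j → i ≡ j
    disjoint   : ∀ i j → i ≢ j → InteriorlyDisjoint (rep i) (rep j)
    adjacency  : ∀ i j → i ≢ j → (Adj i j ⇔ Contact (rep i) (rep j))

IsCorner : {n : ℕ} → (Fin n → Seg) → Point → Set
IsCorner {n} rep p =
  (∃ λ (i : Fin n) → IsVertical (rep i) × OnSeg p (rep i)) ×
  (∃ λ (j : Fin n) → IsHorizontal (rep j) × OnSeg p (rep j))

EnumeratesCorners : {n : ℕ} → (Fin n → Seg) → List Point → Set
EnumeratesCorners rep L = Unique L × (∀ p → (p ∈ L ⇔ IsCorner rep p))

-- Two segments sharing a grid point touch (interior disjointness forces the
-- point to be an endpoint of one of them), so they are adjacent in the hole.
-- A hole on at least four vertices has no triangles, so no grid point lies on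
-- three segments; consequently every corner is the crossing point of exactly
-- one pair of consecutive segments, namely one where the walk around the cycle
-- switches between horizontal and vertical.  Going once around the cycle the
-- orientation returns to its initial value, so it switches an even number of
-- times.
module Submission where

open import Defs
open import Data.Nat using (ℕ; zero; suc; _+_; _≤_; _<_; s≤s; z≤n; NonZero; parity)
open import Data.Nat.Properties
  using (≤-refl; ≤-trans; <⇒≱; <-irrefl; m≤n⇒m<n∨m≡n; m<n⇒m<1+n)
open import Data.Nat.Divisibility using (_∣_; divides)
open import Data.Nat.DivMod using (_mod_; n%n≡0; m<n⇒m%n≡m)
open import Data.Parity.Base as ℙ using (Parity; 0ℙ; 1ℙ)
open import Data.Parity.Properties using (+-assoc; p+p≡0ℙ; +-homo-+)
import Data.Integer as ℤ
import Data.Integer.Properties as ℤ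
open import Data.Fin using (Fin; toℕ)
open import Data.Fin.Properties using (toℕ-injective; toℕ<n; toℕ-fromℕ<; _≟_)
open import Data.Maybe using (Maybe; just; nothing)
open import Data.List using (List; []; _++_; length; fromMaybe)
open import Data.List.Properties using (length-++)
open import Data.List.Membership.Propositional using (_∈_)
open import Data.List.Membership.Propositional.Properties using (∈-++⁻; ∈-++⁺ˡ; ∈-++⁺ʳ)
open import Data.List.Membership.Propositional.Properties.WithK using (unique∧set⇒bag)
open import Data.List.Relation.Unary.Any using (here)
open import Data.List.Relation.Unary.All using ([])
open import Data.List.Relation.Unary.AllPairs using ([]; _∷_)
open import Data.List.Relation.Unary.Unique.Propositional using (Unique)
open import Data.List.Relation.Unary.Unique.Propositional.Properties using (++⁺)
open import Data.List.Relation.Binary.Disjoint.Propositional using (Disjoint)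
open import Data.List.Relation.Binary.BagAndSetEquality using (∼bag⇒↭)
open import Data.List.Relation.Binary.Permutation.Propositional using (_↭_)
open import Data.List.Relation.Binary.Permutation.Propositional.Properties using (↭-length)
open import Data.Empty using (⊥; ⊥-elim)
open import Data.Unit using (tt)
open import Data.Product using (_×_; _,_; ∃)
open import Data.Sum using (_⊎_; inj₁; inj₂)
open import Function using (_∘_)
open import Function.Bundles using (_⇔_; mk⇔; Equivalence)
import Function.Properties.Equivalence as ⇔
open import Relation.Nullary using (¬_; yes; no)
open import Relation.Nullary.Decidable using (decidable-stable)
open import Relation.Binary.PropositionalEquality

Inside : Point → Seg → Set
Inside (px , py) (hor y a b) = py ≡ y × a ℤ.< px × px ℤ.< b
Inside (px , py) (ver x a b) = px ≡ x × a ℤ.< py × py ℤ.< b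

endpoint-or-inside : ∀ {p} s → OnSeg p s → IsEndpoint p s ⊎ Inside p s
endpoint-or-inside {px , _} (hor y a b) (refl , a≤px , px≤b) with px ℤ.≟ a | px ℤ.≟ b
... | yes refl | _        = inj₁ (inj₁ refl)
... | no _     | yes refl = inj₁ (inj₂ refl)
... | no px≢a  | no px≢b  = inj₂ (refl , ℤ.≤∧≢⇒< a≤px (px≢a ∘ sym) , ℤ.≤∧≢⇒< px≤b px≢b)
endpoint-or-inside {_ , py} (ver x a b) (refl , a≤py , py≤b) with py ℤ.≟ a | py ℤ.≟ b
... | yes refl | _        = inj₁ (inj₁ refl)
... | no _     | yes refl = inj₁ (inj₂ refl)
... | no py≢a  | no py≢b  = inj₂ (refl , ℤ.≤∧≢⇒< a≤py (py≢a ∘ sym) , ℤ.≤∧≢⇒< py≤b py≢b)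

inside-both⇒¬interiorlyDisjoint : ∀ {p} s t → Inside p s → Inside p t → ¬ InteriorlyDisjoint s t
inside-both⇒¬interiorlyDisjoint {_ , _} (hor _ _ _) (hor _ _ _) (refl , a<x , x<b) (y≡y′ , c<x , x<d) disjoint =
  disjoint y≡y′ (ℤ.<-trans a<x x<d , ℤ.<-trans c<x x<b)
inside-both⇒¬interiorlyDisjoint {_ , _} (ver _ _ _) (ver _ _ _) (refl , a<y , y<b) (x≡x′ , c<y , y<d) disjoint =
  disjoint x≡x′ (ℤ.<-trans a<y y<d , ℤ.<-trans c<y y<b)
inside-both⇒¬interiorlyDisjoint {_ , _} (hor _ _ _) (ver _ _ _) (refl , a<x , x<b) (refl , c<y , y<d) disjoint =
  disjoint (a<x , x<b , c<y , y<d)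
inside-both⇒¬interiorlyDisjoint {_ , _} (ver _ _ _) (hor _ _ _) (refl , c<y , y<d) (refl , a<x , x<b) disjoint =
  disjoint (a<x , x<b , c<y , y<d)

common-point⇒contact : ∀ {p} s t → OnSeg p s → OnSeg p t → InteriorlyDisjoint s t → Contact s t
common-point⇒contact {p} s t p∈s p∈t disjoint with endpoint-or-inside s p∈s | endpoint-or-inside t p∈t
... | inj₁ end-s | _          = p , p∈s , p∈t , inj₁ end-s
... | inj₂ _     | inj₁ end-t = p , p∈s , p∈t , inj₂ end-t
... | inj₂ in-s  | inj₂ in-t  = ⊥-elim (inside-both⇒¬interiorlyDisjoint s t in-s in-t disjoint)

crossing : Seg → Seg → Maybe Point
crossing (hor y _ _) (ver x _ _) = just (x , y)
crossing (ver x _ _) (hor y _ _) = just (x , y)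
crossing _           _           = nothing

crossing-comm : ∀ s t → crossing s t ≡ crossing t s
crossing-comm (hor _ _ _) (hor _ _ _) = refl
crossing-comm (hor _ _ _) (ver _ _ _) = refl
crossing-comm (ver _ _ _) (hor _ _ _) = refl
crossing-comm (ver _ _ _) (ver _ _ _) = refl

common-point≡crossing : ∀ {r q} s t → OnSeg r s → OnSeg r t → crossing s t ≡ just q → r ≡ q
common-point≡crossing {_ , _} (hor _ _ _) (ver _ _ _) (refl , _) (refl , _) refl = refl
common-point≡crossing {_ , _} (ver _ _ _) (hor _ _ _) (refl , _) (refl , _) refl = refl

contact⇒on-crossing : ∀ {q} s t → Contact s t → crossing s t ≡ just q → OnSeg q s × OnSeg q t
contact⇒on-crossing s t (r , r∈s , r∈t , _) c =
  subst (λ z → OnSeg z s × OnSeg z t) (common-point≡crossing s t r∈s r∈t c) (r∈s , r∈t)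

vertical-horizontal-crossing : ∀ {r} s t → IsVertical s → IsHorizontal t →
                               OnSeg r s → OnSeg r t → crossing s t ≡ just r
vertical-horizontal-crossing {_ , _} (ver _ _ _) (hor _ _ _) _ _ (refl , _) (refl , _) = refl

crossing⇒perpendicular : ∀ {q} s t → crossing s t ≡ just q →
                         (IsVertical s × IsHorizontal t) ⊎ (IsHorizontal s × IsVertical t)
crossing⇒perpendicular (hor _ _ _) (ver _ _ _) _ = inj₂ (tt , tt)
crossing⇒perpendicular (ver _ _ _) (hor _ _ _) _ = inj₁ (tt , tt)

vertical⇒¬horizontal : ∀ s → IsVertical s → ¬ IsHorizontal s
vertical⇒¬horizontal (ver _ _ _) _ ()

orientation : Seg → Parity
orientation (hor _ _ _) = 0ℙ
orientation (ver _ _ _) = 1ℙ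

parity-crossings : ∀ s t → parity (length (fromMaybe (crossing s t))) ≡ orientation s ℙ.+ orientation t
parity-crossings (hor _ _ _) (hor _ _ _) = refl
parity-crossings (hor _ _ _) (ver _ _ _) = refl
parity-crossings (ver _ _ _) (hor _ _ _) = refl
parity-crossings (ver _ _ _) (ver _ _ _) = refl

parity≡0ℙ⇒even : ∀ m → parity m ≡ 0ℙ → 2 ∣ m
parity≡0ℙ⇒even zero          _ = divides 0 refl
parity≡0ℙ⇒even (suc (suc m)) e with parity≡0ℙ⇒even m e
... | divides q refl = divides (suc q) refl

∈-fromMaybe : ∀ {A : Set} {x : A} m → x ∈ fromMaybe m ⇔ m ≡ just x
∈-fromMaybe nothing  = mk⇔ (λ ()) (λ ())
∈-fromMaybe (just _) = mk⇔ (λ { (here refl) → refl }) (λ { refl → here refl })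

fromMaybe-unique : ∀ {A : Set} (m : Maybe A) → Unique (fromMaybe m)
fromMaybe-unique nothing  = []
fromMaybe-unique (just _) = [] ∷ []

module Walk (seg : ℕ → Seg) where

  turnAt : ℕ → Maybe Point
  turnAt k = crossing (seg k) (seg (suc k))

  turns : ℕ → List Point
  turns zero    = []
  turns (suc k) = turns k ++ fromMaybe (turnAt k)

  turns-parity : ∀ K → parity (length (turns K)) ≡ orientation (seg 0) ℙ.+ orientation (seg K)
  turns-parity zero    = sym (p+p≡0ℙ (orientation (seg 0)))
  turns-parity (suc K) = begin
    parity (length (turns K ++ fromMaybe (turnAt K)))
      ≡⟨ cong parity (length-++ (turns K)) ⟩
    parity (length (turns K) + length (fromMaybe (turnAt K)))
      ≡⟨ +-homo-+ (length (turns K)) _ ⟩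
    parity (length (turns K)) ℙ.+ parity (length (fromMaybe (turnAt K)))
      ≡⟨ cong₂ ℙ._+_ (turns-parity K) (parity-crossings (seg K) (seg (suc K))) ⟩
    (o 0 ℙ.+ o K) ℙ.+ (o K ℙ.+ o (suc K))
      ≡⟨ telescope (o 0) (o K) (o (suc K)) ⟩
    o 0 ℙ.+ o (suc K) ∎
    where
    open ≡-Reasoning
    o : ℕ → Parity
    o k = orientation (seg k)
    telescope : ∀ a b c → (a ℙ.+ b) ℙ.+ (b ℙ.+ c) ≡ a ℙ.+ c
    telescope a b c = begin
      (a ℙ.+ b) ℙ.+ (b ℙ.+ c) ≡⟨ +-assoc a b (b ℙ.+ c) ⟩
      a ℙ.+ (b ℙ.+ (b ℙ.+ c)) ≡⟨ cong (a ℙ.+_) (sym (+-assoc b b c)) ⟩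
      a ℙ.+ ((b ℙ.+ b) ℙ.+ c) ≡⟨ cong (λ z → a ℙ.+ (z ℙ.+ c)) (p+p≡0ℙ b) ⟩
      a ℙ.+ c                 ∎

  ∈-turns : ∀ {p} K → p ∈ turns K ⇔ ∃ λ k → k < K × turnAt k ≡ just p
  ∈-turns K = mk⇔ (to K) (from K)
    where
    to : ∀ {p} K → p ∈ turns K → ∃ λ k → k < K × turnAt k ≡ just p
    to (suc K) p∈ with ∈-++⁻ (turns K) p∈
    ... | inj₁ p∈turns = let k , k<K , turn = to K p∈turns in k , m<n⇒m<1+n k<K , turn
    ... | inj₂ p∈last  = K , ≤-refl , Equivalence.to (∈-fromMaybe (turnAt K)) p∈last
    from : ∀ {p} K → (∃ λ k → k < K × turnAt k ≡ just p) → p ∈ turns K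
    from (suc K) (k , s≤s k≤K , turn) with m≤n⇒m<n∨m≡n k≤K
    ... | inj₁ k<K  = ∈-++⁺ˡ (from K (k , k<K , turn))
    ... | inj₂ refl = ∈-++⁺ʳ (turns k) (Equivalence.from (∈-fromMaybe (turnAt k)) turn)

  turns-unique : ∀ K → (∀ {j k p} → j < K → k < K → turnAt j ≡ just p → turnAt k ≡ just p → j ≡ k) →
                 Unique (turns K)
  turns-unique zero    _   = []
  turns-unique (suc K) inj =
    ++⁺ (turns-unique K λ j<K k<K → inj (m<n⇒m<1+n j<K) (m<n⇒m<1+n k<K))
        (fromMaybe-unique (turnAt K)) disjoint
    where
    disjoint : Disjoint (turns K) (fromMaybe (turnAt K))
    disjoint (p∈turns , p∈last) with Equivalence.to (∈-turns K) p∈turns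
    ... | k , k<K , turn =
      <-irrefl (inj (m<n⇒m<1+n k<K) ≤-refl turn (Equivalence.to (∈-fromMaybe (turnAt K)) p∈last)) k<K

Next : ℕ → ℕ → ℕ → Set
Next n a b = suc a ≡ b ⊎ (b ≡ 0 × suc a ≡ n)

next-functional : ∀ {n a b c} → b < n → c < n → Next n a b → Next n a c → b ≡ c
next-functional _   _   (inj₁ refl)       (inj₁ refl)       = refl
next-functional b<n _   (inj₁ refl)       (inj₂ (_ , refl)) = ⊥-elim (<-irrefl refl b<n)
next-functional _   c<n (inj₂ (_ , refl)) (inj₁ refl)       = ⊥-elim (<-irrefl refl c<n)
next-functional _   _   (inj₂ (refl , _)) (inj₂ (refl , _)) = refl

next-injective : ∀ {n a b c} → Next n a c → Next n b c → a ≡ b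
next-injective (inj₁ refl)       (inj₁ refl)       = refl
next-injective (inj₁ refl)       (inj₂ (() , _))
next-injective (inj₂ (refl , _)) (inj₁ ())
next-injective (inj₂ (_ , refl)) (inj₂ (_ , refl)) = refl

next-cycle₁ : ∀ {n a} → Next n a a → n ≤ 1
next-cycle₁ (inj₂ (refl , refl)) = ≤-refl

next-cycle₂ : ∀ {n a b} → Next n a b → Next n b a → n ≤ 2
next-cycle₂ (inj₁ refl)          (inj₂ (refl , refl)) = ≤-refl
next-cycle₂ (inj₂ (refl , refl)) (inj₁ refl)          = ≤-refl
next-cycle₂ (inj₂ (refl , refl)) (inj₂ (refl , _))    = s≤s z≤n

next-cycle₃ : ∀ {n a b c} → Next n a b → Next n b c → Next n c a → n ≤ 3
next-cycle₃ (inj₁ refl)          (inj₁ refl)          (inj₂ (refl , refl)) = ≤-refl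
next-cycle₃ (inj₁ refl)          (inj₂ (refl , refl)) (inj₁ refl)          = ≤-refl
next-cycle₃ (inj₂ (refl , refl)) (inj₁ refl)          (inj₁ refl)          = ≤-refl
next-cycle₃ (inj₂ (refl , refl)) (inj₁ refl)          (inj₂ (refl , ()))
next-cycle₃ (inj₂ (refl , refl)) (inj₂ (refl , refl)) _                    = s≤s z≤n

next-triangle : ∀ {n a b c} → a < n → b < n → c < n → a ≢ b → b ≢ c → a ≢ c →
                Next n a b ⊎ Next n b a → Next n b c ⊎ Next n c b → Next n a c ⊎ Next n c a → n ≤ 3
next-triangle _   b<n c<n _   b≢c _   (inj₁ ab) (inj₁ _)  (inj₁ ac) = ⊥-elim (b≢c (next-functional b<n c<n ab ac))
next-triangle _   _   _   _   _   _   (inj₁ ab) (inj₁ bc) (inj₂ ca) = next-cycle₃ ab bc ca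
next-triangle _   _   _   _   _   a≢c (inj₁ ab) (inj₂ cb) _         = ⊥-elim (a≢c (next-injective ab cb))
next-triangle a<n _   c<n _   _   a≢c (inj₂ ba) (inj₁ bc) _         = ⊥-elim (a≢c (next-functional a<n c<n ba bc))
next-triangle _   _   _   _   _   _   (inj₂ ba) (inj₂ cb) (inj₁ ac) = next-cycle₃ cb ba ac
next-triangle a<n b<n _   a≢b _   _   (inj₂ ba) (inj₂ cb) (inj₂ ca) = ⊥-elim (a≢b (sym (next-functional b<n a<n cb ca)))

cycleAdj⇒next : ∀ {n} {i j : Fin n} → CycleAdj n i j → Next n (toℕ i) (toℕ j) ⊎ Next n (toℕ j) (toℕ i)
cycleAdj⇒next (inj₁ e)                    = inj₁ (inj₁ e)
cycleAdj⇒next (inj₂ (inj₁ e))             = inj₂ (inj₁ e)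
cycleAdj⇒next (inj₂ (inj₂ (inj₁ i0,j+1))) = inj₂ (inj₂ i0,j+1)
cycleAdj⇒next (inj₂ (inj₂ (inj₂ j0,i+1))) = inj₁ (inj₂ j0,i+1)

next⇒cycleAdj : ∀ {n} {i j : Fin n} → Next n (toℕ i) (toℕ j) → CycleAdj n i j
next⇒cycleAdj (inj₁ e)     = inj₁ e
next⇒cycleAdj (inj₂ j0,i+1) = inj₂ (inj₂ (inj₂ j0,i+1))

module Hole {n : ℕ} .{{_ : NonZero n}} (4≤n : 4 ≤ n) {rep : Fin n → Seg}
            (R : IsContactB0VPG n (CycleAdj n) rep) where

  open IsContactB0VPG R

  ≤3⇒n≰ : ∀ {k} → k ≤ 3 → ¬ n ≤ k
  ≤3⇒n≰ k≤3 n≤k = <⇒≱ 4≤n (≤-trans n≤k k≤3)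

  common-point⇒adjacent : ∀ {i j p} → i ≢ j → OnSeg p (rep i) → OnSeg p (rep j) → CycleAdj n i j
  common-point⇒adjacent {i} {j} i≢j p∈i p∈j =
    Equivalence.from (adjacency i j i≢j) (common-point⇒contact (rep i) (rep j) p∈i p∈j (disjoint i j i≢j))

  no-three-on-point : ∀ {i j k p} → i ≢ j → j ≢ k → i ≢ k →
                      OnSeg p (rep i) → OnSeg p (rep j) → OnSeg p (rep k) → ⊥
  no-three-on-point {i} {j} {k} i≢j j≢k i≢k p∈i p∈j p∈k = ≤3⇒n≰ ≤-refl
    (next-triangle (toℕ<n i) (toℕ<n j) (toℕ<n k)
                   (i≢j ∘ toℕ-injective) (j≢k ∘ toℕ-injective) (i≢k ∘ toℕ-injective)
                   (cycleAdj⇒next (common-point⇒adjacent i≢j p∈i p∈j))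
                   (cycleAdj⇒next (common-point⇒adjacent j≢k p∈j p∈k))
                   (cycleAdj⇒next (common-point⇒adjacent i≢k p∈i p∈k)))

  next⇒≢ : ∀ {i j : Fin n} → Next n (toℕ i) (toℕ j) → i ≢ j
  next⇒≢ i→j refl = ≤3⇒n≰ (s≤s z≤n) (next-cycle₁ i→j)

  next⇒contact : ∀ {i j : Fin n} → Next n (toℕ i) (toℕ j) → Contact (rep i) (rep j)
  next⇒contact i→j = Equivalence.to (adjacency _ _ (next⇒≢ i→j)) (next⇒cycleAdj i→j)

  shared-turn⇒same-tail : ∀ {u u⁺ w w⁺ p} → Next n (toℕ u) (toℕ u⁺) → Next n (toℕ w) (toℕ w⁺) →
    OnSeg p (rep u) → OnSeg p (rep u⁺) → OnSeg p (rep w) → OnSeg p (rep w⁺) → u ≡ w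
  -- Otherwise no three segments through p forces w ≡ u⁺ and u ≡ w⁺: a 2-cycle.
  shared-turn⇒same-tail {u} {u⁺} {w} {w⁺} u→u⁺ w→w⁺ p∈u p∈u⁺ p∈w p∈w⁺ =
    decidable-stable (u ≟ w) λ u≢w →
      let w≡u⁺ = decidable-stable (w ≟ u⁺) λ w≢u⁺ → no-three-on-point u≢w w≢u⁺ (next⇒≢ u→u⁺) p∈u p∈w p∈u⁺
          u≡w⁺ = decidable-stable (u ≟ w⁺) λ u≢w⁺ → no-three-on-point u≢w (next⇒≢ w→w⁺) u≢w⁺ p∈u p∈w p∈w⁺
      in ≤3⇒n≰ (s≤s (s≤s z≤n))
           (next-cycle₂ (subst (λ v → Next n (toℕ u) (toℕ v)) (sym w≡u⁺) u→u⁺)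
                        (subst (λ v → Next n (toℕ w) (toℕ v)) (sym u≡w⁺) w→w⁺))

  vertex : ℕ → Fin n
  vertex k = k mod n

  seg : ℕ → Seg
  seg k = rep (vertex k)

  open Walk seg

  toℕ-vertex : ∀ {k} → k < n → toℕ (vertex k) ≡ k
  toℕ-vertex {k} k<n = trans (toℕ-fromℕ< _) (m<n⇒m%n≡m k<n)

  vertex-toℕ : ∀ i → vertex (toℕ i) ≡ i
  vertex-toℕ i = toℕ-injective (toℕ-vertex (toℕ<n i))

  vertex-injective : ∀ {j k} → j < n → k < n → vertex j ≡ vertex k → j ≡ k
  vertex-injective j<n k<n e = trans (sym (toℕ-vertex j<n)) (trans (cong toℕ e) (toℕ-vertex k<n))

  toℕ-vertex-n : toℕ (vertex n) ≡ 0
  toℕ-vertex-n = trans (toℕ-fromℕ< _) (n%n≡0 n)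

  next-vertex : ∀ {k} → k < n → Next n (toℕ (vertex k)) (toℕ (vertex (suc k)))
  next-vertex {k} k<n rewrite toℕ-vertex k<n with m≤n⇒m<n∨m≡n k<n
  ... | inj₁ k+1<n = inj₁ (sym (toℕ-vertex k+1<n))
  ... | inj₂ refl  = inj₂ (toℕ-vertex-n , refl)

  next⇒vertex-suc : ∀ {i j : Fin n} → Next n (toℕ i) (toℕ j) → vertex (suc (toℕ i)) ≡ j
  next⇒vertex-suc {j = j} (inj₁ i+1≡j)        = trans (cong vertex i+1≡j) (vertex-toℕ j)
  next⇒vertex-suc {j = j} (inj₂ (j≡0 , i+1≡n)) =
    toℕ-injective (trans (cong (toℕ ∘ vertex) i+1≡n) (trans toℕ-vertex-n (sym j≡0)))

  turnAt-on : ∀ {k p} → k < n → turnAt k ≡ just p → OnSeg p (seg k) × OnSeg p (seg (suc k))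
  turnAt-on k<n = contact⇒on-crossing (seg _) (seg _) (next⇒contact (next-vertex k<n))

  turnAt-injective : ∀ {j k p} → j < n → k < n → turnAt j ≡ just p → turnAt k ≡ just p → j ≡ k
  turnAt-injective j<n k<n turn-j turn-k with turnAt-on j<n turn-j | turnAt-on k<n turn-k
  ... | p∈j , p∈j⁺ | p∈k , p∈k⁺ = vertex-injective j<n k<n
    (shared-turn⇒same-tail (next-vertex j<n) (next-vertex k<n) p∈j p∈j⁺ p∈k p∈k⁺)

  turnAt-edge : ∀ {i j : Fin n} → Next n (toℕ i) (toℕ j) → turnAt (toℕ i) ≡ crossing (rep i) (rep j)
  turnAt-edge {i} i→j = cong₂ (λ a b → crossing (rep a) (rep b)) (vertex-toℕ i) (next⇒vertex-suc i→j)

  corner⇔turn : ∀ {p} → IsCorner rep p ⇔ ∃ λ k → k < n × turnAt k ≡ just p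
  corner⇔turn = mk⇔ to from
    where
    to : ∀ {p} → IsCorner rep p → ∃ λ k → k < n × turnAt k ≡ just p
    to ((i , vi , p∈i) , (j , hj , p∈j)) with cycleAdj⇒next (common-point⇒adjacent i≢j p∈i p∈j)
      where
      i≢j : i ≢ j
      i≢j refl = vertical⇒¬horizontal (rep i) vi hj
    ... | inj₁ i→j = toℕ i , toℕ<n i ,
      trans (turnAt-edge i→j) (vertical-horizontal-crossing (rep i) (rep j) vi hj p∈i p∈j)
    ... | inj₂ j→i = toℕ j , toℕ<n j ,
      trans (turnAt-edge j→i) (trans (crossing-comm (rep j) (rep i))
                                     (vertical-horizontal-crossing (rep i) (rep j) vi hj p∈i p∈j))
    from : ∀ {p} → (∃ λ k → k < n × turnAt k ≡ just p) → IsCorner rep p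
    from (k , k<n , turn) with turnAt-on k<n turn | crossing⇒perpendicular (seg k) (seg (suc k)) turn
    ... | p∈k , p∈k⁺ | inj₁ (vk , hk⁺) = (vertex k , vk , p∈k) , (vertex (suc k) , hk⁺ , p∈k⁺)
    ... | p∈k , p∈k⁺ | inj₂ (hk , vk⁺) = (vertex (suc k) , vk⁺ , p∈k⁺) , (vertex k , hk , p∈k)

  corners↭turns : ∀ {L} → EnumeratesCorners rep L → L ↭ turns n
  corners↭turns (L-unique , L-corners) = ∼bag⇒↭ (unique∧set⇒bag L-unique (turns-unique n turnAt-injective)
    (⇔.trans (L-corners _) (⇔.trans corner⇔turn (⇔.sym (∈-turns n)))))

  turns-even : parity (length (turns n)) ≡ 0ℙ
  turns-even = begin
    parity (length (turns n))                   ≡⟨ turns-parity n ⟩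
    orientation (seg 0) ℙ.+ orientation (seg n) ≡⟨ cong (λ v → orientation (seg 0) ℙ.+ orientation (rep v)) vertex-n≡vertex-0 ⟩
    orientation (seg 0) ℙ.+ orientation (seg 0) ≡⟨ p+p≡0ℙ (orientation (seg 0)) ⟩
    0ℙ                                          ∎
    where
    open ≡-Reasoning
    vertex-n≡vertex-0 : vertex n ≡ vertex 0
    vertex-n≡vertex-0 = toℕ-injective (trans toℕ-vertex-n (sym (toℕ-vertex (≤-trans (s≤s z≤n) 4≤n))))

lemma9 : (n : ℕ) → 4 ≤ n → (rep : Fin n → Seg) → IsContactB0VPG n (CycleAdj n) rep → (L : List Point) → EnumeratesCorners rep L → 2 ∣ length L
-- Matching n against suc supplies the NonZero instance needed by _mod_.
lemma9 n@(suc _) 4≤n rep R L corners =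
  subst (2 ∣_) (sym (↭-length (corners↭turns corners))) (parity≡0ℙ⇒even _ turns-even)
  where
  open Hole 4≤n R
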